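{- For nonnegative integers $k$ and $l$, $$\sum_{n=0}^{k+l}\frac{(-1)^n}{n+2}\binom{n}{l}\binom{l}{n-k}=\frac{(-1)^{l+k}}{\binom{k+l+2}{l+1}}.$$
   Context: $\binom{l}{j}=0$ for negative integers $j$, and $\binom{n}{l}=0$ when $0\le n<l$. -}

module Defs where

open import Data.Nat as ℕ using (ℕ; zero; suc; _≤_; _<_; z≤n; s≤s; NonZero; _∸_; _+_; >-nonZero)
open import Data.Nat.Properties using (≤-trans; m≤m+n)
open import Data.Nat.Combinatorics using (_C_; nCk+nC[k+1]≡[n+1]C[k+1])
open import Data.Integer as ℤ using (ℤ; +_; -[1+_])
open import Data.Rational as ℚ using (ℚ; _/_)
open import Relation.Binary.PropositionalEquality using (_≡_; refl; subst)

-- Binomial coefficient with integer lower index: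
-- binomℤ l j = (l choose j), which is 0 for negative j (and 0 for j > l,
-- since the stdlib's  n C k  is 0 when k > n).
binomℤ : ℕ → ℤ → ℕ
binomℤ l (+ j)     = l C j
binomℤ l -[1+ _ ]  = 0

sgn : ℕ → ℤ
sgn zero    = + 1
sgn (suc n) = ℤ.- sgn n

sumTo : ℕ → (ℕ → ℚ) → ℚ
sumTo zero    f = f 0
sumTo (suc N) f = sumTo N f ℚ.+ f (suc N)

C-pos : ∀ n k → k ≤ n → 0 < n C k
C-pos n zero _ = s≤s z≤n
C-pos (suc n) (suc k) (s≤s k≤n) =
  subst (0 <_) (nCk+nC[k+1]≡[n+1]C[k+1] n k)
    (≤-trans (C-pos n k k≤n) (m≤m+n (n C k) (n C suc k)))

le : ∀ k l → suc l ≤ k + l + 2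
le zero l = ≤-trans (s≤s (Data.Nat.Properties.n≤1+n l)) (Data.Nat.Properties.≤-reflexive (Data.Nat.Properties.+-comm 2 l))
  where import Data.Nat.Properties
le (suc k) l = ≤-trans (le k l) (Data.Nat.Properties.n≤1+n _)
  where import Data.Nat.Properties

binom-nonZero : ∀ k l → NonZero ((k + l + 2) C suc l)
binom-nonZero k l = >-nonZero (C-pos (k + l + 2) (suc l) (le k l))

-- Write c k l n = (n C l) * (l C (n - k)) and replace the denominator n + 2 by n + t + 1,
-- S t k l = Σₙ (-1)ⁿ c k l n / (n + t + 1).  Pascal's rule in both binomials gives
-- c (k+1) (l+1) (n+1) = c k (l+1) n + c (k+1) l n + c k l n, so shifting n by one yields
-- S t (k+1) (l+1) = -(S (t+1) k (l+1) + S (t+1) (k+1) l + S (t+1) k l), with two-term analogues when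
-- k = 0 or l = 0.  The closed form (-1)^(k+l) (t+l)! (t+k)! / (t! (t+k+l+1)!) obeys the same recurrences
-- and starts at S t 0 0 = 1/(t+1), so induction on k + l identifies the two; at t = 1 the closed form
-- is (-1)^(k+l) / ((k+l+2) C (l+1)).

module Submission where

open import Defs
open import Data.Nat as ℕ using (ℕ; zero; suc; _+_; _*_; _∸_; _!; _≤_; s≤s; NonZero)
import Data.Nat.Properties as ℕ
open import Data.Nat.Combinatorics
  using (_C_; nCn≡1; k>n⇒nCk≡0; nCk+nC[k+1]≡[n+1]C[k+1]; nCk≡n!/k![n-k]!; k![n∸k]!∣n!)
open import Data.Nat.DivMod using (m/n*n≡m)
import Data.Nat.Tactic.RingSolver as ℕ-Solver
open import Data.Integer as ℤ using (ℤ; +_; _⊖_)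
import Data.Integer.Properties as ℤ
import Data.Integer.Tactic.RingSolver as ℤ-Solver
open import Data.Rational as ℚ using (ℚ; _/_; 0ℚ; toℚᵘ)
import Data.Rational.Properties as ℚ
open import Data.Rational.Solver using (module +-*-Solver)
open import Data.Rational.Unnormalised as ℚᵘ using (mkℚᵘ; *≡*)
import Data.Rational.Unnormalised.Properties as ℚᵘ
open import Relation.Binary.Definitions using (tri<; tri≈; tri>)
open import Relation.Binary.PropositionalEquality
import Relation.Binary.Reasoning.Setoid as SetoidReasoning
open import Algebra.Bundles using (CommutativeMonoid)
import Algebra.Properties.CommutativeSemigroup as CommutativeSemigroupProperties

-- binomDiff l n k = l C (n - k), read as 0 when n < k.
binomDiff : ℕ → ℕ → ℕ → ℕ
binomDiff l n       zero    = l C n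
binomDiff l zero    (suc k) = 0
binomDiff l (suc n) (suc k) = binomDiff l n k

binomℤ-⊖ : ∀ l n k → binomℤ l (n ⊖ k) ≡ binomDiff l n k
binomℤ-⊖ l n       zero    = refl
binomℤ-⊖ l zero    (suc k) = refl
binomℤ-⊖ l (suc n) (suc k) = trans (cong (binomℤ l) (ℤ.[1+m]⊖[1+n]≡m⊖n n k)) (binomℤ-⊖ l n k)

binomℤ-[+n]-[+k] : ∀ l n k → binomℤ l (+ n ℤ.- + k) ≡ binomDiff l n k
binomℤ-[+n]-[+k] l n k = trans (cong (binomℤ l) (ℤ.[+m]-[+n]≡m⊖n n k)) (binomℤ-⊖ l n k)

binomDiff-pascal : ∀ l n k → binomDiff (suc l) n k ≡ binomDiff l n (suc k) + binomDiff l n k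
binomDiff-pascal l zero    zero    = refl
binomDiff-pascal l (suc n) zero    = sym (nCk+nC[k+1]≡[n+1]C[k+1] l n)
binomDiff-pascal l zero    (suc k) = refl
binomDiff-pascal l (suc n) (suc k) = binomDiff-pascal l n k

[1+n]C[1+k]*[1+k]C[1+n]≡nCk*kCn : ∀ n k → (suc n C suc k) * (suc k C suc n) ≡ (n C k) * (k C n)
[1+n]C[1+k]*[1+k]C[1+n]≡nCk*kCn n k with ℕ.<-cmp n k
... | tri< n<k _ _ = begin
    (suc n C suc k) * (suc k C suc n)  ≡⟨ cong (_* (suc k C suc n)) (k>n⇒nCk≡0 (s≤s n<k)) ⟩
    0                                  ≡⟨ cong (_* (k C n)) (k>n⇒nCk≡0 n<k) ⟨
    (n C k) * (k C n)                  ∎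
  where open ≡-Reasoning
... | tri≈ _ refl _ = begin
    (suc n C suc n) * (suc n C suc n)  ≡⟨ cong₂ _*_ (nCn≡1 (suc n)) (nCn≡1 (suc n)) ⟩
    1                                  ≡⟨ cong₂ _*_ (nCn≡1 n) (nCn≡1 n) ⟨
    (n C n) * (n C n)                  ∎
  where open ≡-Reasoning
... | tri> _ _ k<n = begin
    (suc n C suc k) * (suc k C suc n)  ≡⟨ cong ((suc n C suc k) *_) (k>n⇒nCk≡0 (s≤s k<n)) ⟩
    (suc n C suc k) * 0                ≡⟨ ℕ.*-zeroʳ (suc n C suc k) ⟩
    0                                  ≡⟨ ℕ.*-zeroʳ (n C k) ⟨
    (n C k) * 0                        ≡⟨ cong ((n C k) *_) (k>n⇒nCk≡0 k<n) ⟨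
    (n C k) * (k C n)                  ∎
  where open ≡-Reasoning

coeff : ℕ → ℕ → ℕ → ℕ
coeff zero    zero    zero    = 1
coeff zero    (suc l) zero    = 0
coeff (suc k) l       zero    = 0
coeff zero    zero    (suc n) = 0
coeff (suc k) zero    (suc n) = coeff k zero n
coeff zero    (suc l) (suc n) = coeff zero l n
coeff (suc k) (suc l) (suc n) = coeff k (suc l) n + coeff (suc k) l n + coeff k l n

coeff≡ : ∀ k l n → coeff k l n ≡ (n C l) * binomDiff l n k
coeff≡ zero    zero    zero    = refl
coeff≡ zero    (suc l) zero    = refl
coeff≡ (suc k) l       zero    = sym (ℕ.*-zeroʳ (0 C l))
coeff≡ zero    zero    (suc n) = sym (ℕ.*-zeroʳ 1)
coeff≡ (suc k) zero    (suc n) = coeff≡ k zero n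
coeff≡ zero    (suc l) (suc n) = trans (coeff≡ zero l n) (sym ([1+n]C[1+k]*[1+k]C[1+n]≡nCk*kCn n l))
coeff≡ (suc k) (suc l) (suc n) = begin
    coeff k (suc l) n + coeff (suc k) l n + coeff k l n
  ≡⟨ cong₂ _+_ (cong₂ _+_ (coeff≡ k (suc l) n) (coeff≡ (suc k) l n)) (coeff≡ k l n) ⟩
    (n C suc l) * binomDiff (suc l) n k + (n C l) * b₁ + (n C l) * b₀
  ≡⟨ cong (λ b → (n C suc l) * b + (n C l) * b₁ + (n C l) * b₀) (binomDiff-pascal l n k) ⟩
    (n C suc l) * (b₁ + b₀) + (n C l) * b₁ + (n C l) * b₀
  ≡⟨ regroup (n C suc l) (n C l) b₁ b₀ ⟩
    (n C l + n C suc l) * (b₁ + b₀)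
  ≡⟨ cong₂ _*_ (nCk+nC[k+1]≡[n+1]C[k+1] n l) (sym (binomDiff-pascal l n k)) ⟩
    (suc n C suc l) * binomDiff (suc l) n k ∎
  where
  open ≡-Reasoning
  b₁ = binomDiff l n (suc k)
  b₀ = binomDiff l n k
  regroup : ∀ x y a b → x * (a + b) + y * a + y * b ≡ (y + x) * (a + b)
  regroup = ℕ-Solver.solve-∀

nCk*[k!*[n∸k]!]≡n! : ∀ {n k} → k ≤ n → (n C k) * (k ! * (n ∸ k) !) ≡ n !
nCk*[k!*[n∸k]!]≡n! {n} {k} k≤n =
  trans (cong (_* (k ! * (n ∸ k) !)) (nCk≡n!/k![n-k]! k≤n))
        (m/n*n≡m {{ℕ._!*_!≢0 k (n ∸ k)}} (k![n∸k]!∣n! k≤n))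

[m+n]Cm*[m!*n!]≡[m+n]! : ∀ m n → ((m + n) C m) * (m ! * n !) ≡ (m + n) !
[m+n]Cm*[m!*n!]≡[m+n]! m n =
  subst (λ r → ((m + n) C m) * (m ! * r !) ≡ (m + n) !) (ℕ.m+n∸m≡n m n) (nCk*[k!*[n∸k]!]≡n! (ℕ.m≤m+n m n))

toℚᵘ-/ : ∀ i d .{{_ : NonZero d}} → toℚᵘ (i / d) ℚᵘ.≃ (i ℚᵘ./ d)
toℚᵘ-/ i (suc d) = ℚ.toℚᵘ-fromℚᵘ (mkℚᵘ i d)

/-cross : ∀ {i j} d e .{{_ : NonZero d}} .{{_ : NonZero e}} → i ℤ.* + e ≡ j ℤ.* + d → i / d ≡ j / e
/-cross {i} {j} (suc d) (suc e) eq = ℚ.fromℚᵘ-cong {mkℚᵘ i d} {mkℚᵘ j e} (*≡* eq)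

/-* : ∀ i j d e .{{_ : NonZero d}} .{{_ : NonZero e}} →
      (i / d) ℚ.* (j / e) ≡ ((i ℤ.* j) / (d * e)) {{ℕ.m*n≢0 d e}}
/-* i j d@(suc _) e@(suc _) = ℚ.toℚᵘ-injective (begin
    toℚᵘ ((i / d) ℚ.* (j / e))          ≈⟨ ℚ.toℚᵘ-homo-* (i / d) (j / e) ⟩
    toℚᵘ (i / d) ℚᵘ.* toℚᵘ (j / e)      ≈⟨ ℚᵘ.*-cong (toℚᵘ-/ i d) (toℚᵘ-/ j e) ⟩
    (i ℚᵘ./ d) ℚᵘ.* (j ℚᵘ./ e)          ≈⟨ toℚᵘ-/ (i ℤ.* j) (d * e) ⟨
    toℚᵘ ((i ℤ.* j) / (d * e))          ∎)
  where open SetoidReasoning ℚᵘ.≃-setoid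

/-+ : ∀ i j d .{{_ : NonZero d}} → (i / d) ℚ.+ (j / d) ≡ (i ℤ.+ j) / d
/-+ i j d@(suc _) = ℚ.toℚᵘ-injective (begin
    toℚᵘ ((i / d) ℚ.+ (j / d))          ≈⟨ ℚ.toℚᵘ-homo-+ (i / d) (j / d) ⟩
    toℚᵘ (i / d) ℚᵘ.+ toℚᵘ (j / d)      ≈⟨ ℚᵘ.+-cong (toℚᵘ-/ i d) (toℚᵘ-/ j d) ⟩
    (i ℚᵘ./ d) ℚᵘ.+ (j ℚᵘ./ d)          ≈⟨ *≡* (common-denominator i j (+ d)) ⟩
    (i ℤ.+ j) ℚᵘ./ d                    ≈⟨ toℚᵘ-/ (i ℤ.+ j) d ⟨
    toℚᵘ ((i ℤ.+ j) / d)                ∎)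
  where
  open SetoidReasoning ℚᵘ.≃-setoid
  common-denominator : ∀ i j d → (i ℤ.* d ℤ.+ j ℤ.* d) ℤ.* d ≡ (i ℤ.+ j) ℤ.* (d ℤ.* d)
  common-denominator = ℤ-Solver.solve-∀

neg-/ : ∀ i d .{{_ : NonZero d}} → ℚ.- (i / d) ≡ (ℤ.- i) / d
neg-/ i d@(suc _) = ℚ.toℚᵘ-injective (begin
    toℚᵘ (ℚ.- (i / d))    ≈⟨ ℚ.toℚᵘ-homo‿- (i / d) ⟩
    ℚᵘ.- toℚᵘ (i / d)     ≈⟨ ℚᵘ.-‿cong (toℚᵘ-/ i d) ⟩
    (ℤ.- i) ℚᵘ./ d        ≈⟨ toℚᵘ-/ (ℤ.- i) d ⟨
    toℚᵘ ((ℤ.- i) / d)    ∎)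
  where open SetoidReasoning ℚᵘ.≃-setoid

opaque
  signed : ℤ → ℕ → (d : ℕ) → .{{NonZero d}} → ℚ
  signed s a d = (s ℤ.* + a) / d

  signed-cong : ∀ {s s′ a a′} d d′ .{{_ : NonZero d}} .{{_ : NonZero d′}} →
                s ≡ s′ → a ≡ a′ → d ≡ d′ → signed s a d ≡ signed s′ a′ d′
  signed-cong d .d refl refl refl = refl

  signed-cross : ∀ s {a b} d e .{{_ : NonZero d}} .{{_ : NonZero e}} →
                 a * e ≡ b * d → signed s a d ≡ signed s b e
  signed-cross s {a} {b} d e eq = /-cross {s ℤ.* + a} {s ℤ.* + b} d e (begin
      s ℤ.* + a ℤ.* + e    ≡⟨ ℤ.*-assoc s (+ a) (+ e) ⟩
      s ℤ.* (+ a ℤ.* + e)  ≡⟨ cong (s ℤ.*_) (ℤ.pos-* a e) ⟨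
      s ℤ.* + (a * e)      ≡⟨ cong (λ x → s ℤ.* + x) eq ⟩
      s ℤ.* + (b * d)      ≡⟨ cong (s ℤ.*_) (ℤ.pos-* b d) ⟩
      s ℤ.* (+ b ℤ.* + d)  ≡⟨ ℤ.*-assoc s (+ b) (+ d) ⟨
      s ℤ.* + b ℤ.* + d    ∎)
    where open ≡-Reasoning

  signed-+ : ∀ s a b d .{{_ : NonZero d}} → signed s a d ℚ.+ signed s b d ≡ signed s (a + b) d
  signed-+ s a b d = trans (/-+ (s ℤ.* + a) (s ℤ.* + b) d) (cong (_/ d) (begin
      s ℤ.* + a ℤ.+ s ℤ.* + b  ≡⟨ ℤ.*-distribˡ-+ s (+ a) (+ b) ⟨
      s ℤ.* (+ a ℤ.+ + b)      ≡⟨ cong (s ℤ.*_) (ℤ.pos-+ a b) ⟨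
      s ℤ.* + (a + b)          ∎))
    where open ≡-Reasoning

  neg-signed : ∀ s a d .{{_ : NonZero d}} → ℚ.- signed s a d ≡ signed (ℤ.- s) a d
  neg-signed s a d = trans (neg-/ (s ℤ.* + a) d) (cong (_/ d) (ℤ.neg-distribˡ-* s (+ a)))

  signed-zero : ∀ s d .{{_ : NonZero d}} → signed s 0 d ≡ 0ℚ
  signed-zero s d = trans (cong (_/ d) (ℤ.*-zeroʳ s)) (ℚ.0/n≡0 d)

  signed≡/ : ∀ s a d .{{_ : NonZero d}} → signed s a d ≡ (s ℤ.* + a) / d
  signed≡/ s a d = refl

signed-sgn-suc : ∀ t a n → signed (sgn (suc n)) a (suc (suc n + t)) ≡ ℚ.- signed (sgn n) a (suc (n + suc t))
signed-sgn-suc t a n =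
  trans (signed-cong (suc (suc n + t)) (suc (n + suc t)) refl refl (cong suc (sym (ℕ.+-suc n t))))
        (sym (neg-signed (sgn n) a (suc (n + suc t))))

sumTo-cong : ∀ N {f g} → (∀ n → f n ≡ g n) → sumTo N f ≡ sumTo N g
sumTo-cong zero    f≡g = f≡g 0
sumTo-cong (suc N) f≡g = cong₂ ℚ._+_ (sumTo-cong N f≡g) (f≡g (suc N))

sumTo-neg : ∀ N f → sumTo N (λ n → ℚ.- f n) ≡ ℚ.- sumTo N f
sumTo-neg zero    f = refl
sumTo-neg (suc N) f = trans (cong (ℚ._+ ℚ.- f (suc N)) (sumTo-neg N f))
                            (sym (ℚ.neg-distrib-+ (sumTo N f) (f (suc N))))

sumTo-+ : ∀ N f g → sumTo N (λ n → f n ℚ.+ g n) ≡ sumTo N f ℚ.+ sumTo N g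
sumTo-+ zero    f g = refl
sumTo-+ (suc N) f g = trans (cong (ℚ._+ (f (suc N) ℚ.+ g (suc N))) (sumTo-+ N f g))
                            (interchange (sumTo N f) (sumTo N g) (f (suc N)) (g (suc N)))
  where open CommutativeSemigroupProperties (CommutativeMonoid.commutativeSemigroup ℚ.+-0-commutativeMonoid)

sumTo-head : ∀ N f → (∀ n → f (suc n) ≡ 0ℚ) → sumTo N f ≡ f 0
sumTo-head zero    f tail≡0 = refl
sumTo-head (suc N) f tail≡0 = begin
    sumTo N f ℚ.+ f (suc N)  ≡⟨ cong₂ ℚ._+_ (sumTo-head N f tail≡0) (tail≡0 N) ⟩
    f 0 ℚ.+ 0ℚ               ≡⟨ ℚ.+-identityʳ (f 0) ⟩
    f 0                      ∎
  where open ≡-Reasoning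

sumTo-tail : ∀ N f → f 0 ≡ 0ℚ → sumTo (suc N) f ≡ sumTo N (λ n → f (suc n))
sumTo-tail zero    f f0≡0 = trans (cong (ℚ._+ f 1) f0≡0) (ℚ.+-identityˡ (f 1))
sumTo-tail (suc N) f f0≡0 = cong (ℚ._+ f (suc (suc N))) (sumTo-tail N f f0≡0)

sumTo-tail-neg : ∀ N {f g} → f 0 ≡ 0ℚ → (∀ n → f (suc n) ≡ ℚ.- g n) →
                 sumTo (suc N) f ≡ ℚ.- sumTo N g
sumTo-tail-neg N {f} {g} f0≡0 step =
  trans (sumTo-tail N f f0≡0) (trans (sumTo-cong N step) (sumTo-neg N g))

term : ℕ → ℕ → ℕ → ℕ → ℚ
term t k l n = signed (sgn n) (coeff k l n) (suc (n + t))

term-suc-suc : ∀ t k l n → term t (suc k) (suc l) (suc n) ≡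
               ℚ.- (term (suc t) k (suc l) n ℚ.+ term (suc t) (suc k) l n ℚ.+ term (suc t) k l n)
term-suc-suc t k l n = trans (signed-sgn-suc t (a + b + c) n) (cong ℚ.-_ (sym (begin
    signed s a d ℚ.+ signed s b d ℚ.+ signed s c d  ≡⟨ cong (ℚ._+ signed s c d) (signed-+ s a b d) ⟩
    signed s (a + b) d ℚ.+ signed s c d            ≡⟨ signed-+ s (a + b) c d ⟩
    signed s (a + b + c) d                         ∎)))
  where
  open ≡-Reasoning
  s = sgn n
  d = suc (n + suc t)
  a = coeff k (suc l) n
  b = coeff (suc k) l n
  c = coeff k l n

Num Den : ℕ → ℕ → ℕ → ℕ
Num t k l = (l + t) ! * (k + t) !
Den t k l = t ! * suc (k + (l + t)) !

Den≢0 : ∀ t k l → NonZero (Den t k l)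
Den≢0 t k l = ℕ._!*_!≢0 t (suc (k + (l + t)))

closed : ℕ → ℕ → ℕ → ℚ
closed t k l = signed (sgn (k + l)) (Num t k l) (Den t k l) {{Den≢0 t k l}}

closed-zeroʳ : ∀ t k → closed t k 0 ≡ signed (sgn k) 1 (suc (k + t))
closed-zeroʳ t k = begin
    closed t k 0
  ≡⟨ signed-cong (Den t k 0) (Den t k 0) {{Den≢0 t k 0}} {{Den≢0 t k 0}} (cong sgn (ℕ.+-identityʳ k)) refl refl ⟩
    signed (sgn k) (Num t k 0) (Den t k 0) {{Den≢0 t k 0}}
  ≡⟨ signed-cross (sgn k) (Den t k 0) (suc (k + t)) {{Den≢0 t k 0}} (cancel (t !) ((k + t) !) (k + t)) ⟩
    signed (sgn k) 1 (suc (k + t)) ∎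
  where
  open ≡-Reasoning
  cancel : ∀ a b m → a * b * suc m ≡ 1 * (a * (suc m * b))
  cancel = ℕ-Solver.solve-∀

closed-zeroˡ : ∀ t l → closed t 0 l ≡ signed (sgn l) 1 (suc (l + t))
closed-zeroˡ t l =
  signed-cross (sgn l) (Den t 0 l) (suc (l + t)) {{Den≢0 t 0 l}} (cancel (t !) ((l + t) !) (l + t))
  where
  cancel : ∀ a b m → b * a * suc m ≡ 1 * (a * (suc m * b))
  cancel = ℕ-Solver.solve-∀

closed-suc-zero : ∀ t k → closed t (suc k) 0 ≡ ℚ.- closed (suc t) k 0
closed-suc-zero t k = begin
    closed t (suc k) 0                        ≡⟨ closed-zeroʳ t (suc k) ⟩
    signed (sgn (suc k)) 1 (suc (suc k + t))  ≡⟨ signed-sgn-suc t 1 k ⟩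
    ℚ.- signed (sgn k) 1 (suc (k + suc t))    ≡⟨ cong ℚ.-_ (closed-zeroʳ (suc t) k) ⟨
    ℚ.- closed (suc t) k 0                    ∎
  where open ≡-Reasoning

closed-zero-suc : ∀ t l → closed t 0 (suc l) ≡ ℚ.- closed (suc t) 0 l
closed-zero-suc t l = begin
    closed t 0 (suc l)                        ≡⟨ closed-zeroˡ t (suc l) ⟩
    signed (sgn (suc l)) 1 (suc (suc l + t))  ≡⟨ signed-sgn-suc t 1 l ⟩
    ℚ.- signed (sgn l) 1 (suc (l + suc t))    ≡⟨ cong ℚ.-_ (closed-zeroˡ (suc t) l) ⟨
    ℚ.- closed (suc t) 0 l                    ∎
  where open ≡-Reasoning

x+w≡y+z⇒x≡-[-y-z+w] : ∀ x y z w → x ℚ.+ w ≡ y ℚ.+ z → x ≡ ℚ.- (ℚ.- y ℚ.+ ℚ.- z ℚ.+ w)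
x+w≡y+z⇒x≡-[-y-z+w] x y z w eq = begin
    x                          ≡⟨ solve 2 (λ x w → x := x :+ w :+ :- w) refl x w ⟩
    x ℚ.+ w ℚ.+ ℚ.- w          ≡⟨ cong (ℚ._+ ℚ.- w) eq ⟩
    y ℚ.+ z ℚ.+ ℚ.- w          ≡⟨ solve 3 (λ y z w → y :+ z :+ :- w := :- (:- y :+ :- z :+ w)) refl y z w ⟩
    ℚ.- (ℚ.- y ℚ.+ ℚ.- z ℚ.+ w) ∎
  where
  open ≡-Reasoning
  open +-*-Solver

-- Over the common denominator D = (t+1)! (t+k+l+3)! the four closed forms have numerators
-- ±(t+l+1)! (t+k+1)! times t+1, t+l+2, t+k+2 and t+k+l+3, and (t+1) + (t+k+l+3) = (t+l+2) + (t+k+2).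
module CommonDenominator (t k l : ℕ) where
  σ : ℤ
  σ = sgn (k + l)
  m P Q D : ℕ
  m = k + (l + t)
  P = suc (l + t) !
  Q = suc (k + t) !
  D = suc t ! * suc (suc (suc m)) !
  instance
    D≢0 : NonZero D
    D≢0 = ℕ._!*_!≢0 (suc t) (suc (suc (suc m)))
    t!*[m+3]!≢0 : NonZero (t ! * suc (suc (suc m)) !)
    t!*[m+3]!≢0 = ℕ._!*_!≢0 t (suc (suc (suc m)))
    [t+1]!*[m+2]!≢0 : NonZero (suc t ! * suc (suc m) !)
    [t+1]!*[m+2]!≢0 = ℕ._!*_!≢0 (suc t) (suc (suc m))
  M₀ M₁ M₂ M₃ : ℕ
  M₀ = P * Q * suc t
  M₁ = suc (suc (l + t)) ! * Q
  M₂ = P * suc (suc (k + t)) !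
  M₃ = P * Q * suc (suc (suc m))

  k+[l+1+t]≡1+m : k + (l + suc t) ≡ suc m
  k+[l+1+t]≡1+m = trans (cong (_+_ k) (ℕ.+-suc l t)) (ℕ.+-suc k (l + t))

  closed[t,1+k,1+l]≡ : closed t (suc k) (suc l) ≡ signed σ M₀ D
  closed[t,1+k,1+l]≡ = begin
      closed t (suc k) (suc l)
    ≡⟨ signed-cong (Den t (suc k) (suc l)) (t ! * suc (suc (suc m)) !) {{Den≢0 t (suc k) (suc l)}}
         (trans (cong (λ j → ℤ.- sgn j) (ℕ.+-suc k l)) (ℤ.neg-involutive σ)) refl
         (cong (λ j → t ! * suc (suc j) !) (ℕ.+-suc k (l + t))) ⟩
      signed σ (P * Q) (t ! * suc (suc (suc m)) !)
    ≡⟨ signed-cross σ (t ! * suc (suc (suc m)) !) D (cancel (P * Q) (t !) (suc (suc (suc m)) !) t) ⟩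
      signed σ M₀ D ∎
    where
    open ≡-Reasoning
    cancel : ∀ a f g t → a * ((suc t * f) * g) ≡ a * suc t * (f * g)
    cancel = ℕ-Solver.solve-∀

  closed[1+t,k,1+l]≡ : closed (suc t) k (suc l) ≡ ℚ.- signed σ M₁ D
  closed[1+t,k,1+l]≡ =
    trans (signed-cong (Den (suc t) k (suc l)) D {{Den≢0 (suc t) k (suc l)}}
            (cong sgn (ℕ.+-suc k l))
            (cong₂ (λ i j → suc i ! * j !) (ℕ.+-suc l t) (ℕ.+-suc k t))
            (cong (λ j → suc t ! * suc j !) (trans (ℕ.+-suc k (l + suc t)) (cong suc k+[l+1+t]≡1+m))))
          (sym (neg-signed σ M₁ D))

  closed[1+t,1+k,l]≡ : closed (suc t) (suc k) l ≡ ℚ.- signed σ M₂ D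
  closed[1+t,1+k,l]≡ =
    trans (signed-cong (Den (suc t) (suc k) l) D {{Den≢0 (suc t) (suc k) l}} refl
            (cong₂ (λ i j → i ! * suc j !) (ℕ.+-suc l t) (ℕ.+-suc k t))
            (cong (λ j → suc t ! * suc (suc j) !) k+[l+1+t]≡1+m))
          (sym (neg-signed σ M₂ D))

  closed[1+t,k,l]≡ : closed (suc t) k l ≡ signed σ M₃ D
  closed[1+t,k,l]≡ = begin
      closed (suc t) k l
    ≡⟨ signed-cong (Den (suc t) k l) (suc t ! * suc (suc m) !) {{Den≢0 (suc t) k l}} refl
         (cong₂ (λ i j → i ! * j !) (ℕ.+-suc l t) (ℕ.+-suc k t))
         (cong (λ j → suc t ! * suc j !) k+[l+1+t]≡1+m) ⟩
      signed σ (P * Q) (suc t ! * suc (suc m) !)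
    ≡⟨ signed-cross σ (suc t ! * suc (suc m) !) D (cancel (P * Q) (suc t !) (suc (suc m) !) m) ⟩
      signed σ M₃ D ∎
    where
    open ≡-Reasoning
    cancel : ∀ a f g m → a * (f * (suc (suc (suc m)) * g)) ≡ a * suc (suc (suc m)) * (f * g)
    cancel = ℕ-Solver.solve-∀

  M₀+M₃≡M₁+M₂ : signed σ M₀ D ℚ.+ signed σ M₃ D ≡ signed σ M₁ D ℚ.+ signed σ M₂ D
  M₀+M₃≡M₁+M₂ = begin
      signed σ M₀ D ℚ.+ signed σ M₃ D  ≡⟨ signed-+ σ M₀ M₃ D ⟩
      signed σ (M₀ + M₃) D             ≡⟨ cong (λ a → signed σ a D) (numerators P Q t k l) ⟩
      signed σ (M₁ + M₂) D             ≡⟨ signed-+ σ M₁ M₂ D ⟨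
      signed σ M₁ D ℚ.+ signed σ M₂ D  ∎
    where
    open ≡-Reasoning
    numerators : ∀ P Q t k l → P * Q * suc t + P * Q * suc (suc (suc (k + (l + t)))) ≡
                               suc (suc (l + t)) * P * Q + P * (suc (suc (k + t)) * Q)
    numerators = ℕ-Solver.solve-∀

closed-suc-suc : ∀ t k l → closed t (suc k) (suc l) ≡
                 ℚ.- (closed (suc t) k (suc l) ℚ.+ closed (suc t) (suc k) l ℚ.+ closed (suc t) k l)
closed-suc-suc t k l = begin
    closed t (suc k) (suc l)
  ≡⟨ closed[t,1+k,1+l]≡ ⟩
    signed σ M₀ D
  ≡⟨ x+w≡y+z⇒x≡-[-y-z+w] (signed σ M₀ D) (signed σ M₁ D) (signed σ M₂ D) (signed σ M₃ D) M₀+M₃≡M₁+M₂ ⟩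
    ℚ.- (ℚ.- signed σ M₁ D ℚ.+ ℚ.- signed σ M₂ D ℚ.+ signed σ M₃ D)
  ≡⟨ cong ℚ.-_ (cong₂ ℚ._+_ (cong₂ ℚ._+_ closed[1+t,k,1+l]≡ closed[1+t,1+k,l]≡) closed[1+t,k,l]≡) ⟨
    ℚ.- (closed (suc t) k (suc l) ℚ.+ closed (suc t) (suc k) l ℚ.+ closed (suc t) k l) ∎
  where
  open ≡-Reasoning
  open CommonDenominator t k l

sumTo-term≡closed : ∀ N t k l → k + l ≤ N → sumTo N (term t k l) ≡ closed t k l
sumTo-term≡closed N t zero zero _ =
  trans (sumTo-head N (term t 0 0) (λ n → signed-zero (sgn (suc n)) (suc (suc n + t))))
        (sym (closed-zeroʳ t 0))
sumTo-term≡closed (suc N) t (suc k) zero (s≤s k≤N) = begin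
    sumTo (suc N) (term t (suc k) 0)
  ≡⟨ sumTo-tail-neg N (signed-zero (sgn 0) (suc t)) (λ n → signed-sgn-suc t (coeff k 0 n) n) ⟩
    ℚ.- sumTo N (term (suc t) k 0)
  ≡⟨ cong ℚ.-_ (sumTo-term≡closed N (suc t) k 0 k≤N) ⟩
    ℚ.- closed (suc t) k 0
  ≡⟨ closed-suc-zero t k ⟨
    closed t (suc k) 0 ∎
  where open ≡-Reasoning
sumTo-term≡closed (suc N) t zero (suc l) (s≤s l≤N) = begin
    sumTo (suc N) (term t 0 (suc l))
  ≡⟨ sumTo-tail-neg N (signed-zero (sgn 0) (suc t)) (λ n → signed-sgn-suc t (coeff 0 l n) n) ⟩
    ℚ.- sumTo N (term (suc t) 0 l)
  ≡⟨ cong ℚ.-_ (sumTo-term≡closed N (suc t) 0 l l≤N) ⟩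
    ℚ.- closed (suc t) 0 l
  ≡⟨ closed-zero-suc t l ⟨
    closed t 0 (suc l) ∎
  where open ≡-Reasoning
sumTo-term≡closed (suc N) t (suc k) (suc l) (s≤s k+1+l≤N) = begin
    sumTo (suc N) (term t (suc k) (suc l))
  ≡⟨ sumTo-tail-neg N (signed-zero (sgn 0) (suc t)) (term-suc-suc t k l) ⟩
    ℚ.- sumTo N (λ n → term (suc t) k (suc l) n ℚ.+ term (suc t) (suc k) l n ℚ.+ term (suc t) k l n)
  ≡⟨ cong ℚ.-_ (trans (sumTo-+ N _ _) (cong (ℚ._+ sumTo N (term (suc t) k l)) (sumTo-+ N _ _))) ⟩
    ℚ.- (sumTo N (term (suc t) k (suc l)) ℚ.+ sumTo N (term (suc t) (suc k) l) ℚ.+ sumTo N (term (suc t) k l))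
  ≡⟨ cong ℚ.-_ (cong₂ ℚ._+_ (cong₂ ℚ._+_ (sumTo-term≡closed N (suc t) k (suc l) k+1+l≤N)
                                                 (sumTo-term≡closed N (suc t) (suc k) l k+1+l≤N′))
                                 (sumTo-term≡closed N (suc t) k l (ℕ.<⇒≤ k+1+l≤N′))) ⟩
    ℚ.- (closed (suc t) k (suc l) ℚ.+ closed (suc t) (suc k) l ℚ.+ closed (suc t) k l)
  ≡⟨ closed-suc-suc t k l ⟨
    closed t (suc k) (suc l) ∎
  where
  open ≡-Reasoning
  k+1+l≤N′ : suc k + l ≤ N
  k+1+l≤N′ = subst (_≤ N) (ℕ.+-suc k l) k+1+l≤N

summand≡term : ∀ k l n → (sgn n / suc (suc n)) ℚ.* ((+ (n C l)) / 1) ℚ.* ((+ binomℤ l (+ n ℤ.- + k)) / 1)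
                         ≡ term 1 k l n
summand≡term k l n = begin
    (sgn n / suc (suc n)) ℚ.* (+ (n C l) / 1) ℚ.* (+ b / 1)
  ≡⟨ cong (ℚ._* (+ b / 1)) (/-* (sgn n) (+ (n C l)) (suc (suc n)) 1) ⟩
    ((sgn n ℤ.* + (n C l)) / (suc (suc n) * 1)) ℚ.* (+ b / 1)
  ≡⟨ /-* (sgn n ℤ.* + (n C l)) (+ b) (suc (suc n) * 1) 1 ⟩
    (sgn n ℤ.* + (n C l) ℤ.* + b) / (suc (suc n) * 1 * 1)
  ≡⟨ ℚ./-cong numerator denominator ⟩
    (sgn n ℤ.* + coeff k l n) / suc (n + 1)
  ≡⟨ signed≡/ (sgn n) (coeff k l n) (suc (n + 1)) ⟨
    term 1 k l n ∎
  where
  open ≡-Reasoning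
  b = binomℤ l (+ n ℤ.- + k)
  numerator : sgn n ℤ.* + (n C l) ℤ.* + b ≡ sgn n ℤ.* + coeff k l n
  numerator = begin
      sgn n ℤ.* + (n C l) ℤ.* + b                 ≡⟨ ℤ.*-assoc (sgn n) (+ (n C l)) (+ b) ⟩
      sgn n ℤ.* (+ (n C l) ℤ.* + b)               ≡⟨ cong (sgn n ℤ.*_) (ℤ.pos-* (n C l) b) ⟨
      sgn n ℤ.* + ((n C l) * b)                   ≡⟨ cong (λ c → sgn n ℤ.* + ((n C l) * c)) (binomℤ-[+n]-[+k] l n k) ⟩
      sgn n ℤ.* + ((n C l) * binomDiff l n k)     ≡⟨ cong (λ c → sgn n ℤ.* + c) (coeff≡ k l n) ⟨
      sgn n ℤ.* + coeff k l n                     ∎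
  denominator : suc (suc n) * 1 * 1 ≡ suc (n + 1)
  denominator = trans (ℕ.*-identityʳ (suc (suc n) * 1))
                      (trans (ℕ.*-identityʳ (suc (suc n))) (cong suc (ℕ.+-comm 1 n)))

closed-one : ∀ k l → closed 1 k l ≡ (sgn (l + k) / ((k + l + 2) C suc l)) {{binom-nonZero k l}}
closed-one k l = begin
    closed 1 k l
  ≡⟨ signed-cong (Den 1 k l) (Den 1 k l) {{Den≢0 1 k l}} {{Den≢0 1 k l}} (cong sgn (ℕ.+-comm k l)) refl refl ⟩
    signed (sgn (l + k)) (Num 1 k l) (Den 1 k l) {{Den≢0 1 k l}}
  ≡⟨ signed-cross (sgn (l + k)) (Den 1 k l) c {{Den≢0 1 k l}} {{binom-nonZero k l}} cross ⟩
    signed (sgn (l + k)) 1 c {{binom-nonZero k l}}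
  ≡⟨ signed≡/ (sgn (l + k)) 1 c {{binom-nonZero k l}} ⟩
    (sgn (l + k) ℤ.* + 1 / c) {{binom-nonZero k l}}
  ≡⟨ cong (λ i → (i / c) {{binom-nonZero k l}}) (ℤ.*-identityʳ (sgn (l + k))) ⟩
    (sgn (l + k) / c) {{binom-nonZero k l}} ∎
  where
  open ≡-Reasoning
  c = (k + l + 2) C suc l
  cross : Num 1 k l * c ≡ 1 * Den 1 k l
  cross = begin
      (l + 1) ! * (k + 1) ! * c                   ≡⟨ cong₂ (λ i j → i ! * j ! * c) (ℕ.+-comm l 1) (ℕ.+-comm k 1) ⟩
      suc l ! * suc k ! * c                       ≡⟨ ℕ.*-comm (suc l ! * suc k !) c ⟩
      c * (suc l ! * suc k !)                     ≡⟨ cong (λ m → (m C suc l) * (suc l ! * suc k !)) (sizes k l) ⟩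
      ((suc l + suc k) C suc l) * (suc l ! * suc k !) ≡⟨ [m+n]Cm*[m!*n!]≡[m+n]! (suc l) (suc k) ⟩
      (suc l + suc k) !                           ≡⟨ cong _! (sizes′ k l) ⟩
      suc (k + (l + 1)) !                         ≡⟨ ℕ.*-identityˡ _ ⟨
      1 ! * suc (k + (l + 1)) !                   ≡⟨ ℕ.*-identityˡ _ ⟨
      1 * Den 1 k l                               ∎
    where
    sizes : ∀ k l → k + l + 2 ≡ suc l + suc k
    sizes = ℕ-Solver.solve-∀
    sizes′ : ∀ k l → suc l + suc k ≡ suc (k + (l + 1))
    sizes′ = ℕ-Solver.solve-∀

lemma3p1 : (k l : ℕ) →
    sumTo (k + l) (λ n → (sgn n / suc (suc n)) ℚ.* ((+ (n C l)) / 1) ℚ.* ((+ binomℤ l (+ n ℤ.- + k)) / 1))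
    ≡ (sgn (l + k) / ((k + l + 2) C suc l)) {{binom-nonZero k l}}
lemma3p1 k l = begin
    sumTo (k + l) (λ n → (sgn n / suc (suc n)) ℚ.* ((+ (n C l)) / 1) ℚ.* ((+ binomℤ l (+ n ℤ.- + k)) / 1))
  ≡⟨ sumTo-cong (k + l) (summand≡term k l) ⟩
    sumTo (k + l) (term 1 k l)
  ≡⟨ sumTo-term≡closed (k + l) 1 k l ℕ.≤-refl ⟩
    closed 1 k l
  ≡⟨ closed-one k l ⟩
    (sgn (l + k) / ((k + l + 2) C suc l)) {{binom-nonZero k l}} ∎
  where open ≡-Reasoning
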